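{- The scheme $(\mathrm{Iab}_C\varphi\wedge\mathrm{Iab}_C\psi)\rightarrow\mathrm{Iab}_C(\varphi\vee\psi)$ is not valid: there exist a finite non-empty set of agents $N$, a coalition $C\subseteq N$, formulas $\varphi,\psi$, a coalition model $\mathcal{M}$ over $N$ and a state $s$ with $\mathcal{M},s\models\mathrm{Iab}_C\varphi\wedge\mathrm{Iab}_C\psi$ and $\mathcal{M},s\not\models\mathrm{Iab}_C(\varphi\vee\psi)$.
   Context: A coalition is any $C\subseteq N$, $\overline{C}=N\setminus C$. Formulas: $\varphi ::= p \mid \neg\varphi \mid (\varphi\wedge\psi) \mid [C]\varphi \mid \mathrm{Iab}_C\varphi$ over a countable set $\mathrm{Prop}$ of variables, with $\vee$ as usual. A coalition model is $\mathcal{M}=(S,\{Act_i\}_{i\in N},o,V)$ with $S$ non-empty, each $Act_i$ non-empty, $o:S\times\prod_{i\in N}Act_i\to S$, $V:\mathrm{Prop}\to 2^S$; $Act_C=\prod_{i\in C}Act_i$ ($Act_\emptyset$ contains only the empty profile). $\mathcal{M},s\models[C]\varphi$ iff there is $\sigma_C\in Act_C$ such that for all $\sigma_{\overline{C}}\in Act_{\overline{C}}$, $\mathcal{M},o(s,\sigma_C,\sigma_{\overline{C}})\models\varphi$; $\mathcal{M},s\models\mathrm{Iab}_C\varphi$ iff $\mathcal{M},s\not\models[C]\varphi$; atoms and Boolean connectives as usual. -}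

module Defs where

open import Data.Nat using (ℕ; suc)
open import Data.Fin using (Fin)
open import Data.Bool using (Bool; true; false; T; not)
open import Data.Product using (Σ; _×_; _,_)
open import Data.Sum using (_⊎_)
open import Data.Empty using (⊥)
open import Relation.Nullary using (¬_)

Coalition : ℕ → Set
Coalition n = Fin n → Bool

co : ∀ {n} → Coalition n → Coalition n
co C i = not (C i)

data Formula (n : ℕ) : Set where
  var  : ℕ → Formula n
  ¬'_  : Formula n → Formula n
  _∧'_ : Formula n → Formula n → Formula n
  [_]_ : Coalition n → Formula n → Formula n
  Iab  : Coalition n → Formula n → Formula n

_∨'_ : ∀ {n} → Formula n → Formula n → Formula n
φ ∨' ψ = ¬' ((¬' φ) ∧' (¬' ψ))

record Model (n : ℕ) : Set₁ where
  field
    S        : Set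
    S-ne     : S
    Act      : Fin n → Set
    Act-ne   : (i : Fin n) → Act i
    o        : S → ((i : Fin n) → Act i) → S
    V        : ℕ → S → Set

-- Action profile of a coalition C: an action for each member of C
-- (for C = ∅ this type has exactly one element up to extensionality)
Profile : ∀ {n} (M : Model n) → Coalition n → Set
Profile {n} M C = (i : Fin n) → T (C i) → Model.Act M i

combine : ∀ {n} (M : Model n) (C : Coalition n) →
          Profile M C → Profile M (co C) → (i : Fin n) → Model.Act M i
combine M C σ τ i with C i | σ i | τ i
... | true  | σi | _  = σi _
... | false | _  | τi = τi _

_,_⊨_ : ∀ {n} (M : Model n) → Model.S M → Formula n → Set
M , s ⊨ var p   = Model.V M p s
M , s ⊨ (¬' φ)  = ¬ (M , s ⊨ φ)
M , s ⊨ (φ ∧' ψ) = (M , s ⊨ φ) × (M , s ⊨ ψ)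
M , s ⊨ ([ C ] φ) = Σ (Profile M C) λ σ → (τ : Profile M (co C)) →
                      M , Model.o M s (combine M C σ τ) ⊨ φ
M , s ⊨ (Iab C φ) = ¬ (Σ (Profile M C) λ σ → (τ : Profile M (co C)) →
                      M , Model.o M s (combine M C σ τ) ⊨ φ)

-- With one agent and the empty coalition, Iab_∅ φ says that the agent can steer the
-- system into a state where φ fails. Let the agent choose the next state in Bool, with
-- p true exactly at true and q exactly at false: it can falsify p and it can falsify q,
-- but p ∨ q holds everywhere, so every coalition can force it.
module Submission where

open import Defs
open import Data.Nat using (ℕ; zero; suc)
open import Data.Fin using (Fin)
open import Data.Bool using (Bool; true; false; T; not)
open import Data.Product using (Σ; _×_; _,_)
open import Data.Unit using (tt)
open import Relation.Nullary using (¬_)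

Valid : ∀ {n} → Model n → Formula n → Set
Valid M φ = ∀ s → M , s ⊨ φ

valid⇒¬Iab : ∀ {n} (M : Model n) (C : Coalition n) (φ : Formula n) →
             Valid M φ → ∀ s → ¬ (M , s ⊨ Iab C φ)
valid⇒¬Iab M C φ valid s unable = unable ((λ i _ → Model.Act-ne M i) , λ _ → valid _)

∅ : ∀ {n} → Coalition n
∅ _ = false

agent : Fin 1
agent = Fin.zero

chooser : Model 1
chooser = record
  { S = Bool ; S-ne = true ; Act = λ _ → Bool ; Act-ne = λ _ → true
  ; o = λ _ a → a agent
  ; V = λ { zero s → T s ; (suc _) s → T (not s) } }

play : Bool → Profile chooser (co ∅)
play b _ _ = b

Iab∅-p : ∀ s → chooser , s ⊨ Iab ∅ (var 0)
Iab∅-p s (_ , forced) = forced (play false)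

Iab∅-q : ∀ s → chooser , s ⊨ Iab ∅ (var 1)
Iab∅-q s (_ , forced) = forced (play true)

p∨q-valid : Valid chooser (var 0 ∨' var 1)
p∨q-valid true  (¬p , _) = ¬p tt
p∨q-valid false (_ , ¬q) = ¬q tt

proposition4p12 : Σ ℕ λ n → Σ (Coalition (suc n)) λ C →
    Σ (Formula (suc n)) λ φ → Σ (Formula (suc n)) λ ψ →
    Σ (Model (suc n)) λ M → Σ (Model.S M) λ s →
    (M , s ⊨ (Iab C φ ∧' Iab C ψ)) × ¬ (M , s ⊨ Iab C (φ ∨' ψ))
proposition4p12 =
  0 , ∅ , var 0 , var 1 , chooser , true ,
  (Iab∅-p true , Iab∅-q true) , valid⇒¬Iab chooser ∅ (var 0 ∨' var 1) p∨q-valid true
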